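{- Let $a,b$ be integers with $a-1>b\ge 1$, let $\varphi(0)=0^a1$, $\varphi(1)=0^b1$, and let $u_\beta=\lim_{n\to\infty}\varphi^n(0)$. For each $z\in\{\varepsilon,0,1\}$ there exists at most one infinite palindromic branch of $u_\beta$ with center $z$.
   Context: Let $v=v_1v_2v_3\cdots$ be a right-infinite word over $\{0,1\}$, $\overline v=\cdots v_3v_2v_1$ the corresponding left-infinite word, and $z\in\{\varepsilon,0,1\}$ ($\varepsilon$ the empty word). If for every $n\in\mathbb N$ the palindrome $v_nv_{n-1}\cdots v_1zv_1v_2\cdots v_n$ is a factor of $u_\beta$, then the bidirectional infinite word $\overline v z v$ is called an infinite palindromic branch of $u_\beta$ with center $z$. -}

module Defs where

open import Data.Nat using (ℕ; zero; suc; _+_)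
open import Data.Fin using (Fin) renaming (zero to fz; suc to fs)
open import Data.List using (List; []; _∷_; _++_; replicate; concatMap; reverse; map; upTo)
open import Data.Maybe using (Maybe; nothing; just)
open import Data.Product using (∃)
open import Relation.Binary.PropositionalEquality using (_≡_)

Letter : Set
Letter = Fin 2

φ : ℕ → ℕ → Letter → List Letter
φ a b fz      = replicate a fz ++ (fs fz ∷ [])
φ a b (fs fz) = replicate b fz ++ (fs fz ∷ [])

φ* : ℕ → ℕ → List Letter → List Letter
φ* a b = concatMap (φ a b)

iterφ : ℕ → ℕ → ℕ → List Letter
iterφ a b zero    = fz ∷ []
iterφ a b (suc n) = φ* a b (iterφ a b n)

-- i-th letter (0-based) of a finite word, with a dummy default out of range
nth : List Letter → ℕ → Letter
nth []       _       = fz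
nth (x ∷ xs) zero    = x
nth (x ∷ xs) (suc i) = nth xs i

-- u_β = lim φ^n(0), as a function ℕ → Letter (0-based positions).
-- Since φ(0) starts with 0, φ^n(0) is a prefix of φ^(n+1)(0), and
-- |φ^n(0)| ≥ n+1 (as a ≥ 1), so the i-th letter of the limit is the
-- i-th letter of φ^(i+1)(0).
u : ℕ → ℕ → ℕ → Letter
u a b i = nth (iterφ a b (suc i)) i

IsFactor : (ℕ → Letter) → List Letter → Set
IsFactor x w = ∃ λ i → map (λ k → x (i + k)) (upTo (Data.List.length w)) ≡ w

-- the prefix v_1 … v_n of a right-infinite word v (v_1 = v 0)
prefix : (ℕ → Letter) → ℕ → List Letter
prefix v n = map v (upTo n)

centerWord : Maybe Letter → List Letter
centerWord nothing  = []
centerWord (just c) = c ∷ []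

palindromeAt : (ℕ → Letter) → Maybe Letter → ℕ → List Letter
palindromeAt v z n = reverse (prefix v n) ++ centerWord z ++ prefix v n

IsPalBranch : (ℕ → Letter) → Maybe Letter → (ℕ → Letter) → Set
IsPalBranch x z v = (n : ℕ) → IsFactor x (palindromeAt v z n)

{-# OPTIONS --safe #-}
-- The factors of u cut uniquely into the blocks φ(0) = 0^a 1 and φ(1) = 0^b 1 (as a ≠ b), and none contains
-- more than a consecutive zeros. Hence the right arm of a long palindromic factor p̃ z p reads p = 0^k 1 φ(c) 0^j,
-- and p̃ z p is, up to its outer zeros, the φ-image of a shorter palindromic factor: of c̃ d c with
-- φ(d) = 0^k z 0^k 1 if z ∈ {ε, 0}, and of c̃ d d c with φ(d) = 0^k 1 if z = 1.
-- By induction on N, two long enough palindromic factors with center z agree on the first N letters of their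
-- arms. For z = 1 the hypothesis for the arms d c (center ε) fixes d, hence k. For z ∈ {ε, 0} the block length
-- r(d) = 2k + |z| fixes d unless a and b both have the parity of |z|; but then there are no long palindromes
-- with center 0 (a, b even: the central block would be odd), resp. 1 (a, b odd: the preimage has center ε and
-- an even central block), and one of two different candidates for d would be such a center. So k is fixed too,
-- the hypothesis for the arms c (center d) applies, and k with the first N letters of c fixes N + 1 letters of p.
module Submission where

open import Defs
open import Data.Nat using (ℕ; zero; suc; _+_; _*_; _≤_; _<_; z≤n; s≤s; s≤s⁻¹; _≤?_)
open import Data.Nat.Properties
open import Data.Fin using () renaming (zero to fz; suc to fs)
open import Data.List using (List; []; _∷_; _++_; _∷ʳ_; replicate; reverse; map; upTo; applyUpTo; length; take; drop)
open import Data.List.Properties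
  using (++-assoc; ++-identityʳ; ++-monoid; ∷-injective; ∷-injectiveʳ; concatMap-++; length-++; length-replicate;
         length-map; length-upTo; length-applyUpTo; unfold-reverse; reverse-++; take-map; take++drop≡id; length-take;
         map-upTo; applyUpTo-∷ʳ; ∷ʳ-injectiveʳ)
open import Data.Maybe using (Maybe; nothing; just)
open import Data.Product using (∃; ∃₂; _×_; _,_)
open import Data.Sum using (_⊎_; inj₁; inj₂)
open import Data.Empty using (⊥; ⊥-elim)
open import Relation.Nullary using (yes; no)
open import Relation.Binary.PropositionalEquality
open import Algebra.Solver.Monoid (++-monoid Letter) using (solve; _⊜_; _⊕_)

pattern O = fz
pattern I = fs fz

infix 8 0^_
0^_ : ℕ → List Letter
0^ n = replicate n O

replicate-++ : ∀ {A : Set} m n (x : A) → replicate m x ++ replicate n x ≡ replicate (m + n) x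
replicate-++ zero    n x = refl
replicate-++ (suc m) n x = cong (x ∷_) (replicate-++ m n x)

reverse-replicate : ∀ {A : Set} n (x : A) → reverse (replicate n x) ≡ replicate n x
reverse-replicate zero    x = refl
reverse-replicate (suc n) x = begin
  reverse (x ∷ replicate n x)     ≡⟨ unfold-reverse x (replicate n x) ⟩
  reverse (replicate n x) ∷ʳ x    ≡⟨ cong (_∷ʳ x) (reverse-replicate n x) ⟩
  replicate n x ++ replicate 1 x  ≡⟨ replicate-++ n 1 x ⟩
  replicate (n + 1) x             ≡⟨ cong (λ m → replicate m x) (+-comm n 1) ⟩
  replicate (suc n) x             ∎
  where open ≡-Reasoning

++-∷-≢-[] : ∀ {A : Set} (xs : List A) {y ys} → xs ++ y ∷ ys ≢ []
++-∷-≢-[] []      ()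
++-∷-≢-[] (_ ∷ _) ()

++-regroup : ∀ {A : Set} (xs ys zs us vs : List A) → (xs ++ ys) ++ zs ++ us ++ vs ≡ xs ++ (ys ++ zs ++ us) ++ vs
++-regroup xs ys zs us vs = begin
  (xs ++ ys) ++ zs ++ us ++ vs    ≡⟨ ++-assoc xs ys (zs ++ us ++ vs) ⟩
  xs ++ ys ++ zs ++ us ++ vs      ≡⟨ cong (λ t → xs ++ ys ++ t) (sym (++-assoc zs us vs)) ⟩
  xs ++ ys ++ (zs ++ us) ++ vs    ≡⟨ cong (xs ++_) (sym (++-assoc ys (zs ++ us) vs)) ⟩
  xs ++ (ys ++ zs ++ us) ++ vs    ∎
  where open ≡-Reasoning

take-++ˡ : ∀ {A : Set} M (xs : List A) {ys} → M ≤ length xs → take M (xs ++ ys) ≡ take M xs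
take-++ˡ zero    xs       _         = refl
take-++ˡ (suc M) (x ∷ xs) (s≤s M≤n) = cong (x ∷_) (take-++ˡ M xs M≤n)

take-applyUpTo : ∀ {A : Set} (f : ℕ → A) {m n} → m ≤ n → take m (applyUpTo f n) ≡ applyUpTo f m
take-applyUpTo f z≤n       = refl
take-applyUpTo f (s≤s m≤n) = cong (f 0 ∷_) (take-applyUpTo (λ k → f (suc k)) m≤n)

applyUpTo-+ : ∀ {A : Set} (f : ℕ → A) m n → applyUpTo f (m + n) ≡ applyUpTo f m ++ applyUpTo (λ k → f (m + k)) n
applyUpTo-+ f zero    n = refl
applyUpTo-+ f (suc m) n = cong (f 0 ∷_) (applyUpTo-+ (λ k → f (suc k)) m n)

n<m+1+2n : ∀ m n → n < m + suc (2 * n)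
n<m+1+2n m n = ≤-trans (s≤s (m≤n*m n 2)) (m≤n+m _ m)

0^-++ : ∀ m n X → 0^ m ++ 0^ n ++ X ≡ 0^ (m + n) ++ X
0^-++ m n X = trans (sym (++-assoc (0^ m) (0^ n) X)) (cong (_++ X) (replicate-++ m n O))

0^-∷ : ∀ k Y → 0^ k ++ O ∷ Y ≡ O ∷ 0^ k ++ Y
0^-∷ zero    Y = refl
0^-∷ (suc k) Y = cong (O ∷_) (0^-∷ k Y)

0^-double : ∀ k X → 0^ k ++ 0^ k ++ X ≡ 0^ (2 * k) ++ X
0^-double k X = trans (0^-++ k k X) (cong (λ n → 0^ (k + n) ++ X) (sym (+-identityʳ k)))

0^-double-suc : ∀ k X → 0^ k ++ O ∷ 0^ k ++ X ≡ 0^ suc (2 * k) ++ X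
0^-double-suc k X = trans (0^-∷ k (0^ k ++ X)) (cong (O ∷_) (0^-double k X))

take-1-0^ : ∀ {k} X → 1 ≤ k → take 1 (0^ k ++ X) ≡ O ∷ []
take-1-0^ X (s≤s _) = refl

length-arm : ∀ k xs j → length (0^ k ++ I ∷ xs ++ 0^ j) ≡ k + suc (length xs + j)
length-arm k xs j = begin
  length (0^ k ++ I ∷ xs ++ 0^ j)             ≡⟨ length-++ (0^ k) ⟩
  length (0^ k) + suc (length (xs ++ 0^ j))   ≡⟨ cong₂ (λ m n → m + suc n) (length-replicate k) (length-++ xs) ⟩
  k + suc (length xs + length (0^ j))         ≡⟨ cong (λ n → k + suc (length xs + n)) (length-replicate j) ⟩
  k + suc (length xs + j)                     ∎
  where open ≡-Reasoning

block-injective : ∀ {r m A B} → 0^ r ++ I ∷ A ≡ 0^ m ++ I ∷ B → r ≡ m × A ≡ B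
block-injective {zero}  {zero}  refl = refl , refl
block-injective {zero}  {suc m} ()
block-injective {suc r} {zero}  ()
block-injective {suc r} {suc m} e with block-injective (∷-injectiveʳ e)
... | refl , A≡B = refl , A≡B

block-split : ∀ r xs {A B} → 0^ r ++ I ∷ A ≡ xs ++ I ∷ B →
  (xs ≡ 0^ r × A ≡ B) ⊎ (∃ λ xs' → xs ≡ 0^ r ++ I ∷ xs' × A ≡ xs' ++ I ∷ B)
block-split zero    []       refl = inj₁ (refl , refl)
block-split zero    (_ ∷ xs) refl = inj₂ (xs , refl , refl)
block-split (suc r) []       ()
block-split (suc r) (_ ∷ xs) e with ∷-injective e
... | refl , e' with block-split r xs e'
...   | inj₁ (refl , A≡B)        = inj₁ (refl , A≡B)
...   | inj₂ (xs' , refl , A≡)   = inj₂ (xs' , refl , A≡)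

block-≢-0^ : ∀ {r n A zs} → r ≤ n → 0^ r ++ I ∷ A ≢ 0^ suc n ++ zs
block-≢-0^ {zero}  _         ()
block-≢-0^ {suc r} (s≤s r≤n) e = block-≢-0^ r≤n (∷-injectiveʳ e)

block-before-0^ : ∀ {r n} xs {A zs} → r ≤ n → 0^ r ++ I ∷ A ≡ xs ++ 0^ suc n ++ zs →
  ∃ λ xs' → xs ≡ 0^ r ++ I ∷ xs' × A ≡ xs' ++ 0^ suc n ++ zs
block-before-0^          []       r≤n e    = ⊥-elim (block-≢-0^ r≤n e)
block-before-0^ {zero}   (_ ∷ xs) _   refl = xs , refl , refl
block-before-0^ {suc r}  (_ ∷ xs) r≤n e with ∷-injective e
... | refl , e' with block-before-0^ xs (≤-trans (n≤1+n r) r≤n) e'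
...   | xs' , refl , A≡ = xs' , refl , A≡

leading-zeros : ∀ n p → n ≤ length p → (∃ λ e → p ≡ 0^ n ++ e) ⊎ (∃₂ λ k t → k < n × p ≡ 0^ k ++ I ∷ t)
leading-zeros zero    p       _        = inj₁ (p , refl)
leading-zeros (suc n) (O ∷ p) (s≤s n≤) with leading-zeros n p n≤
... | inj₁ (e , refl)              = inj₁ (e , refl)
... | inj₂ (k , t , k<n , refl)    = inj₂ (suc k , t , s≤s k<n , refl)
leading-zeros (suc n) (I ∷ p) _        = inj₂ (0 , p , s≤s z≤n , refl)

trailing-zeros : ∀ t → ∃ λ j → t ≡ 0^ j ⊎ ∃ λ s → t ≡ s ++ I ∷ 0^ j
trailing-zeros [] = 0 , inj₁ refl
trailing-zeros (O ∷ t) with trailing-zeros t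
... | j , inj₁ refl       = suc j , inj₁ refl
... | j , inj₂ (s , refl) = j , inj₂ (O ∷ s , refl)
trailing-zeros (I ∷ t) with trailing-zeros t
... | j , inj₁ refl       = j , inj₂ ([] , refl)
... | j , inj₂ (s , refl) = j , inj₂ (I ∷ s , refl)

take-prefix : ∀ (v : ℕ → Letter) {m n} → m ≤ n → take m (prefix v n) ≡ prefix v m
take-prefix v {m} {n} m≤n = begin
  take m (map v (upTo n))  ≡⟨ take-map m (upTo n) ⟩
  map v (take m (upTo n))  ≡⟨ cong (map v) (take-applyUpTo (λ k → k) m≤n) ⟩
  map v (upTo m)           ∎
  where open ≡-Reasoning

length-prefix : ∀ (v : ℕ → Letter) n → length (prefix v n) ≡ n
length-prefix v n = trans (length-map v (upTo n)) (length-upTo n)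

prefix-last : ∀ (v w : ℕ → Letter) n → prefix v (suc n) ≡ prefix w (suc n) → v n ≡ w n
prefix-last v w n eq = ∷ʳ-injectiveʳ (applyUpTo v n) (applyUpTo w n) (begin
  applyUpTo v n ∷ʳ v n  ≡⟨ applyUpTo-∷ʳ v n ⟩
  applyUpTo v (suc n)   ≡⟨ sym (map-upTo v (suc n)) ⟩
  prefix v (suc n)      ≡⟨ eq ⟩
  prefix w (suc n)      ≡⟨ map-upTo w (suc n) ⟩
  applyUpTo w (suc n)   ≡⟨ sym (applyUpTo-∷ʳ w n) ⟩
  applyUpTo w n ∷ʳ w n  ∎)
  where open ≡-Reasoning

extend-prefix : ∀ xs {e L : List Letter} → xs ++ e ≡ L → length xs < length L →
  ∃ λ rest → (xs ∷ʳ nth L (length xs)) ++ rest ≡ L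
extend-prefix []       {y ∷ e} refl _         = e , refl
extend-prefix (x ∷ xs)         refl (s≤s lt) with extend-prefix xs refl lt
... | rest , eq = rest , cong (x ∷_) eq

limit : (ℕ → List Letter) → ℕ → Letter
limit L j = nth (L (suc j)) j

module Limit (L : ℕ → List Letter) (L-prefix : ∀ m → ∃ λ e → L m ++ e ≡ L (suc m))
             (L-long : ∀ m → m < length (L m)) where

  prefix-of-limit : ∀ n → ∃ λ e → applyUpTo (limit L) n ++ e ≡ L n
  prefix-of-limit zero = L 0 , refl
  prefix-of-limit (suc n) with prefix-of-limit n | L-prefix n
  ... | e , eq | e' , eq' with extend-prefix (applyUpTo (limit L) n) {e ++ e'} xs++e++e'≡ shorter
    where
    xs++e++e'≡ : applyUpTo (limit L) n ++ e ++ e' ≡ L (suc n)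
    xs++e++e'≡ = trans (sym (++-assoc (applyUpTo (limit L) n) e e')) (trans (cong (_++ e') eq) eq')
    shorter : length (applyUpTo (limit L) n) < length (L (suc n))
    shorter = subst (_< length (L (suc n))) (sym (length-applyUpTo (limit L) n)) (<-trans (n<1+n n) (L-long (suc n)))
  ... | rest , eq'' = rest , (begin
    applyUpTo (limit L) (suc n) ++ rest
      ≡⟨ cong (_++ rest) (sym (applyUpTo-∷ʳ (limit L) n)) ⟩
    (applyUpTo (limit L) n ∷ʳ nth (L (suc n)) n) ++ rest
      ≡⟨ cong (λ i → (applyUpTo (limit L) n ∷ʳ nth (L (suc n)) i) ++ rest) (sym (length-applyUpTo (limit L) n)) ⟩
    (applyUpTo (limit L) n ∷ʳ nth (L (suc n)) (length (applyUpTo (limit L) n))) ++ rest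
      ≡⟨ eq'' ⟩
    L (suc n) ∎)
    where open ≡-Reasoning

  factor-of-limit : ∀ {w} → IsFactor (limit L) w → ∃ λ m → ∃₂ λ xs zs → xs ++ w ++ zs ≡ L m
  factor-of-limit {w} (i , eq) with prefix-of-limit (i + length w)
  ... | e , eq' = i + length w , applyUpTo (limit L) i , e , (begin
    applyUpTo (limit L) i ++ w ++ e
      ≡⟨ cong (λ t → applyUpTo (limit L) i ++ t ++ e) (trans (sym eq) (map-upTo _ (length w))) ⟩
    applyUpTo (limit L) i ++ applyUpTo (λ k → limit L (i + k)) (length w) ++ e
      ≡⟨ sym (++-assoc (applyUpTo (limit L) i) _ e) ⟩
    (applyUpTo (limit L) i ++ applyUpTo (λ k → limit L (i + k)) (length w)) ++ e
      ≡⟨ cong (_++ e) (sym (applyUpTo-+ (limit L) i (length w))) ⟩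
    applyUpTo (limit L) (i + length w) ++ e
      ≡⟨ eq' ⟩
    L (i + length w) ∎)
    where open ≡-Reasoning

iterφ-0-prefix : ∀ {a} b → 1 ≤ a → ∃ λ e → iterφ a b 0 ++ e ≡ iterφ a b 1
iterφ-0-prefix b (s≤s _) = _ , refl

module Substitution (a b : ℕ) (1≤b : 1 ≤ b) (b<a : b < a) where

  r : Letter → ℕ
  r O = a
  r I = b

  1≤r : ∀ x → 1 ≤ r x
  1≤r O = ≤-trans 1≤b (<⇒≤ b<a)
  1≤r I = 1≤b

  r≤a : ∀ x → r x ≤ a
  r≤a O = ≤-refl
  r≤a I = <⇒≤ b<a

  r-injective : ∀ {x y} → r x ≡ r y → x ≡ y
  r-injective {O} {O} _   = refl
  r-injective {O} {I} a≡b = ⊥-elim (<-irrefl (sym a≡b) b<a)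
  r-injective {I} {O} b≡a = ⊥-elim (<-irrefl b≡a b<a)
  r-injective {I} {I} _   = refl

  F : List Letter → List Letter
  F = φ* a b

  F-++ : ∀ X Y → F (X ++ Y) ≡ F X ++ F Y
  F-++ = concatMap-++ (φ a b)

  F-∷ : ∀ x X → F (x ∷ X) ≡ 0^ r x ++ I ∷ F X
  F-∷ O X = ++-assoc (0^ a) (I ∷ []) (F X)
  F-∷ I X = ++-assoc (0^ b) (I ∷ []) (F X)

  F-∷-++ : ∀ x X Y → F (x ∷ X) ++ Y ≡ 0^ r x ++ I ∷ F X ++ Y
  F-∷-++ x X Y = trans (cong (_++ Y) (F-∷ x X)) (++-assoc (0^ r x) (I ∷ F X) Y)

  F-block : ∀ d {m} X Y → r d ≡ m → 0^ m ++ I ∷ F X ++ Y ≡ F (d ∷ X) ++ Y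
  F-block d X Y refl = sym (F-∷-++ d X Y)

  reverse-F : ∀ c Y → reverse (F c) ++ I ∷ Y ≡ I ∷ F (reverse c) ++ Y
  reverse-F []      Y = refl
  reverse-F (x ∷ c) Y = begin
    reverse (F (x ∷ c)) ++ I ∷ Y                    ≡⟨ cong (λ t → reverse t ++ I ∷ Y) (F-∷ x c) ⟩
    reverse (0^ r x ++ I ∷ F c) ++ I ∷ Y            ≡⟨ cong (_++ I ∷ Y) (reverse-++ (0^ r x) (I ∷ F c)) ⟩
    (reverse (I ∷ F c) ++ reverse (0^ r x)) ++ I ∷ Y
      ≡⟨ cong₂ (λ s t → (s ++ t) ++ I ∷ Y) (unfold-reverse I (F c)) (reverse-replicate (r x) O) ⟩
    ((reverse (F c) ∷ʳ I) ++ 0^ r x) ++ I ∷ Y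
      ≡⟨ solve 4 (λ R i Z y → ((R ⊕ i) ⊕ Z) ⊕ (i ⊕ y) ⊜ R ⊕ (i ⊕ (Z ⊕ (i ⊕ y)))) refl (reverse (F c)) (I ∷ []) (0^ r x) Y ⟩
    reverse (F c) ++ I ∷ 0^ r x ++ I ∷ Y            ≡⟨ reverse-F c (0^ r x ++ I ∷ Y) ⟩
    I ∷ F (reverse c) ++ 0^ r x ++ I ∷ Y            ≡⟨ cong (λ t → I ∷ F (reverse c) ++ t) (sym (F-∷-++ x [] Y)) ⟩
    I ∷ F (reverse c) ++ F (x ∷ []) ++ Y            ≡⟨ cong (I ∷_) (sym (++-assoc (F (reverse c)) (F (x ∷ [])) Y)) ⟩
    I ∷ (F (reverse c) ++ F (x ∷ [])) ++ Y          ≡⟨ cong (λ t → I ∷ t ++ Y) (sym (F-++ (reverse c) (x ∷ []))) ⟩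
    I ∷ F (reverse c ∷ʳ x) ++ Y                     ≡⟨ cong (λ t → I ∷ F t ++ Y) (sym (unfold-reverse x c)) ⟩
    I ∷ F (reverse (x ∷ c)) ++ Y                    ∎
    where open ≡-Reasoning

  length-F-∷ : ∀ x X → length (F (x ∷ X)) ≡ r x + suc (length (F X))
  length-F-∷ x X = begin
    length (F (x ∷ X))                    ≡⟨ cong length (F-∷ x X) ⟩
    length (0^ r x ++ I ∷ F X)            ≡⟨ length-++ (0^ r x) ⟩
    length (0^ r x) + suc (length (F X))  ≡⟨ cong (_+ suc (length (F X))) (length-replicate (r x)) ⟩
    r x + suc (length (F X))              ∎
    where open ≡-Reasoning

  length-F-≤ : ∀ X → length (F X) ≤ suc a * length X
  length-F-≤ []      = z≤n
  length-F-≤ (x ∷ X) = begin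
    length (F (x ∷ X))           ≡⟨ length-F-∷ x X ⟩
    r x + suc (length (F X))     ≤⟨ +-mono-≤ (r≤a x) (s≤s (length-F-≤ X)) ⟩
    a + suc (suc a * length X)   ≡⟨ +-suc a _ ⟩
    suc a + suc a * length X     ≡⟨ sym (*-suc (suc a) (length X)) ⟩
    suc a * suc (length X)       ∎
    where open ≤-Reasoning

  length-F-≥ : ∀ X → 2 * length X ≤ length (F X)
  length-F-≥ []      = z≤n
  length-F-≥ (x ∷ X) = begin
    2 * suc (length X)           ≡⟨ *-suc 2 (length X) ⟩
    2 + 2 * length X             ≤⟨ +-mono-≤ (1≤r x) (s≤s (length-F-≥ X)) ⟩
    r x + suc (length (F X))     ≡⟨ sym (length-F-∷ x X) ⟩
    length (F (x ∷ X))           ∎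
    where open ≤-Reasoning

  F-head : ∀ C {m Y} → F C ≡ 0^ m ++ I ∷ Y → ∃₂ λ d C' → C ≡ d ∷ C' × r d ≡ m × F C' ≡ Y
  F-head []      {zero}  ()
  F-head []      {suc m} ()
  F-head (d ∷ C) e with block-injective (trans (sym (F-∷ d C)) e)
  ... | refl , FC≡Y = d , C , refl , refl , FC≡Y

  F-cancelˡ : ∀ C X {Y} → F C ≡ F X ++ Y → ∃ λ C' → C ≡ X ++ C' × F C' ≡ Y
  F-cancelˡ C []      e = C , refl , e
  F-cancelˡ C (x ∷ X) e with F-head C (trans e (F-∷-++ x X _))
  ... | d , C' , refl , rd≡rx , FC'≡ with r-injective rd≡rx
  ... | refl with F-cancelˡ C' X FC'≡
  ... | C'' , refl , FC''≡Y = C'' , refl , FC''≡Y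

  F-split-at-I : ∀ W xs {B} → xs ++ I ∷ B ≡ F W →
    ∃₂ λ W₁ W₂ → W ≡ W₁ ++ W₂ × F W₁ ≡ xs ∷ʳ I × F W₂ ≡ B
  F-split-at-I []      xs e = ⊥-elim (++-∷-≢-[] xs e)
  F-split-at-I (w ∷ W) xs e with block-split (r w) xs (trans (sym (F-∷ w W)) (sym e))
  ... | inj₁ (refl , FW≡B) = w ∷ [] , W , refl , F-∷ w [] , FW≡B
  ... | inj₂ (xs' , refl , FW≡) with F-split-at-I W xs' (sym FW≡)
  ... | W₁ , W₂ , refl , FW₁≡ , FW₂≡B = w ∷ W₁ , W₂ , refl , FwW₁≡ , FW₂≡B
    where
    FwW₁≡ : F (w ∷ W₁) ≡ (0^ r w ++ I ∷ xs') ∷ʳ I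
    FwW₁≡ = trans (F-∷ w W₁) (trans (cong (λ t → 0^ r w ++ I ∷ t) FW₁≡) (sym (++-assoc (0^ r w) (I ∷ xs') (I ∷ []))))

  0^a+1∉F : ∀ W xs {zs} → xs ++ 0^ suc a ++ zs ≢ F W
  0^a+1∉F []      xs e = ++-∷-≢-[] xs e
  0^a+1∉F (w ∷ W) xs e with block-before-0^ xs (r≤a w) (trans (sym (F-∷ w W)) (sym e))
  ... | xs' , _ , FW≡ = 0^a+1∉F W xs' (sym FW≡)

  zero-run-in-F-≤ : ∀ W xs {j zs} → xs ++ 0^ j ++ zs ≡ F W → j ≤ a
  zero-run-in-F-≤ W xs {j} {zs} e with j ≤? a
  ... | yes j≤a = j≤a
  ... | no  j≰a with m≤n⇒∃[o]m+o≡n (≰⇒> j≰a)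
  ... | o , refl = ⊥-elim (0^a+1∉F W xs (trans (cong (xs ++_) (0^-++ (suc a) o zs)) e))

  F-prefix-shape : ∀ C t {e} → F C ≡ t ++ e → ∃₂ λ c j → t ≡ F c ++ 0^ j × j ≤ a
  F-prefix-shape C t {e} FC≡ with trailing-zeros t
  ... | j , inj₁ refl       = [] , j , refl , zero-run-in-F-≤ C [] (sym FC≡)
  ... | j , inj₂ (s , refl) with F-split-at-I C s (sym (trans FC≡ (++-assoc s (I ∷ 0^ j) e)))
  ... | C₁ , _ , _ , FC₁≡ , _ = C₁ , j , s++I∷0^j≡ , zero-run-in-F-≤ C (s ∷ʳ I) (sym FC≡')
    where
    open ≡-Reasoning
    s++I∷0^j≡ : s ++ I ∷ 0^ j ≡ F C₁ ++ 0^ j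
    s++I∷0^j≡ = begin
      s ++ I ∷ 0^ j       ≡⟨ sym (++-assoc s (I ∷ []) (0^ j)) ⟩
      (s ∷ʳ I) ++ 0^ j    ≡⟨ cong (_++ 0^ j) (sym FC₁≡) ⟩
      F C₁ ++ 0^ j        ∎
    FC≡' : F C ≡ (s ∷ʳ I) ++ 0^ j ++ e
    FC≡' = trans FC≡ (solve 4 (λ S i J E → (S ⊕ (i ⊕ J)) ⊕ E ⊜ (S ⊕ i) ⊕ (J ⊕ E)) refl s (I ∷ []) (0^ j) e)

  iterφ-prefix : ∀ m → ∃ λ e → iterφ a b m ++ e ≡ iterφ a b (suc m)
  iterφ-prefix zero    = iterφ-0-prefix b (1≤r O)
  iterφ-prefix (suc m) with iterφ-prefix m
  ... | e , eq = F e , trans (sym (F-++ (iterφ a b m) e)) (cong F eq)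

  length-iterφ : ∀ m → m < length (iterφ a b m)
  length-iterφ zero    = s≤s z≤n
  length-iterφ (suc m) = begin
    suc (suc m)                    ≤⟨ s≤s (m<m+n m (s≤s z≤n)) ⟩
    2 * suc m                      ≤⟨ *-monoʳ-≤ 2 (length-iterφ m) ⟩
    2 * length (iterφ a b m)       ≤⟨ length-F-≥ (iterφ a b m) ⟩
    length (iterφ a b (suc m))     ∎
    where open ≤-Reasoning

  Factor : List Letter → Set
  Factor w = ∃ λ m → ∃₂ λ xs zs → xs ++ w ++ zs ≡ iterφ a b m

  factor-infix : ∀ xs w ys → Factor (xs ++ w ++ ys) → Factor w
  factor-infix xs w ys (m , xs' , zs , eq) = m , xs' ++ xs , ys ++ zs , trans (++-regroup xs' xs w ys zs) eq

  factor-prefix : ∀ w ys → Factor (w ++ ys) → Factor w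
  factor-prefix = factor-infix []

  factor-suffix : ∀ xs w → Factor (xs ++ w) → Factor w
  factor-suffix xs w f = factor-infix xs w [] (subst (λ t → Factor (xs ++ t)) (sym (++-identityʳ w)) f)

  u-factor : ∀ {w} → IsFactor (u a b) w → Factor w
  u-factor = Limit.factor-of-limit (iterφ a b) iterφ-prefix length-iterφ

  factor-in-image : ∀ {w} → Factor w → ∃₂ λ W xs → ∃ λ zs → xs ++ w ++ zs ≡ F W × Factor W
  factor-in-image {w} (m , xs , zs , eq) with iterφ-prefix m
  ... | e , eq' = iterφ a b m , xs , zs ++ e , xs++w++zs++e≡ , (m , [] , [] , ++-identityʳ (iterφ a b m))
    where
    xs++w++zs++e≡ : xs ++ w ++ zs ++ e ≡ F (iterφ a b m)
    xs++w++zs++e≡ = trans (solve 4 (λ A B C D → A ⊕ (B ⊕ (C ⊕ D)) ⊜ (A ⊕ (B ⊕ C)) ⊕ D) refl xs w zs e)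
                          (trans (cong (_++ e) eq) eq')

  factor-after-I : ∀ {ys} → Factor (I ∷ ys) → ∃₂ λ C e → F C ≡ ys ++ e × Factor C
  factor-after-I f with factor-in-image f
  ... | W , xs , zs , eq , fW with F-split-at-I W xs eq
  ... | W₁ , W₂ , refl , _ , FW₂≡ = W₂ , zs , FW₂≡ , factor-suffix W₁ W₂ fW

  factor-zero-run-≤ : ∀ xs {j zs} → Factor (xs ++ 0^ j ++ zs) → j ≤ a
  factor-zero-run-≤ xs {j} {zs} f with factor-in-image f
  ... | W , xs' , zs' , eq , _ = zero-run-in-F-≤ W (xs' ++ xs) (trans (++-regroup xs' xs (0^ j) zs zs') eq)

  factor-preimage : ∀ X Y {C e} → Factor (X ++ C) → F C ≡ F Y ++ e → Factor (X ++ Y)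
  factor-preimage X Y {C} f FC≡ with F-cancelˡ C Y FC≡
  ... | C' , refl , _ = factor-prefix (X ++ Y) C' (subst Factor (sym (++-assoc X Y C')) f)

module Palindromes (a b : ℕ) (1≤b : 1 ≤ b) (b<a : b < a) where

  open Substitution a b 1≤b b<a

  PalFactor : Maybe Letter → List Letter → Set
  PalFactor z p = Factor (reverse p ++ centerWord z ++ p)

  arm-factor : ∀ z p → PalFactor z p → Factor p
  arm-factor z p f = factor-suffix (centerWord z) p (factor-suffix (reverse p) (centerWord z ++ p) f)

  reverse-arm : ∀ k c j X → reverse (0^ k ++ I ∷ F c ++ 0^ j) ++ X ≡ 0^ j ++ I ∷ F (reverse c) ++ 0^ k ++ X
  reverse-arm k c j X = begin
    reverse (0^ k ++ I ∷ F c ++ 0^ j) ++ X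
      ≡⟨ cong (_++ X) (reverse-++ (0^ k) (I ∷ F c ++ 0^ j)) ⟩
    (reverse (I ∷ F c ++ 0^ j) ++ reverse (0^ k)) ++ X
      ≡⟨ cong₂ (λ s t → (s ++ t) ++ X) (unfold-reverse I (F c ++ 0^ j)) (reverse-replicate k O) ⟩
    ((reverse (F c ++ 0^ j) ∷ʳ I) ++ 0^ k) ++ X
      ≡⟨ cong (λ s → ((s ∷ʳ I) ++ 0^ k) ++ X) (reverse-++ (F c) (0^ j)) ⟩
    (((reverse (0^ j) ++ reverse (F c)) ∷ʳ I) ++ 0^ k) ++ X
      ≡⟨ cong (λ s → (((s ++ reverse (F c)) ∷ʳ I) ++ 0^ k) ++ X) (reverse-replicate j O) ⟩
    (((0^ j ++ reverse (F c)) ∷ʳ I) ++ 0^ k) ++ X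
      ≡⟨ solve 5 (λ J R i K Y → (((J ⊕ R) ⊕ i) ⊕ K) ⊕ Y ⊜ J ⊕ (R ⊕ (i ⊕ (K ⊕ Y)))) refl (0^ j) (reverse (F c)) (I ∷ []) (0^ k) X ⟩
    0^ j ++ reverse (F c) ++ I ∷ 0^ k ++ X
      ≡⟨ cong (0^ j ++_) (reverse-F c (0^ k ++ X)) ⟩
    0^ j ++ I ∷ F (reverse c) ++ 0^ k ++ X ∎
    where open ≡-Reasoning

  -- p̃ z p, where p = 0^k 1 φ(c) 0^j, is φ(c̃ d c) up to its outer zeros if z ∈ {ε, 0}, and φ(c̃ d d c) if z = 1.
  PalPreimage : Maybe Letter → ℕ → List Letter → Set
  PalPreimage nothing  k c = ∃ λ d → r d ≡ 2 * k × PalFactor (just d) c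
  PalPreimage (just O) k c = ∃ λ d → r d ≡ suc (2 * k) × PalFactor (just d) c
  PalPreimage (just I) k c = ∃ λ d → r d ≡ k × PalFactor nothing (d ∷ c)

  block-preimage : ∀ {m c C e} → Factor (reverse c ++ C) → F C ≡ 0^ m ++ I ∷ F c ++ e →
    ∃ λ d → r d ≡ m × PalFactor (just d) c
  block-preimage {c = c} {C} {e} f FC≡ with F-head C FC≡
  ... | d , _ , _ , rd , _ = d , rd , factor-preimage (reverse c) (d ∷ c) f (trans FC≡ (F-block d c e rd))

  preimage-from-image : ∀ z {k c C e} → Factor (reverse c ++ C) →
    F C ≡ 0^ k ++ centerWord z ++ 0^ k ++ I ∷ F c ++ e → PalPreimage z k c
  preimage-from-image nothing  {k} f FC≡ = block-preimage f (trans FC≡ (0^-double k _))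
  preimage-from-image (just O) {k} f FC≡ = block-preimage f (trans FC≡ (0^-double-suc k _))
  preimage-from-image (just I) {k} {c} {C} {e} f FC≡ with F-head C FC≡
  ... | d , _ , _ , rd , _ = d , rd , subst Factor reverse-d∷c (factor-preimage (reverse c) (d ∷ d ∷ c) f FC≡')
    where
    FC≡' : F C ≡ F (d ∷ d ∷ c) ++ e
    FC≡' = trans FC≡ (trans (cong (λ t → 0^ k ++ I ∷ t) (F-block d c e rd)) (F-block d (d ∷ c) e rd))
    reverse-d∷c : reverse c ++ d ∷ d ∷ c ≡ reverse (d ∷ c) ++ d ∷ c
    reverse-d∷c = trans (sym (++-assoc (reverse c) (d ∷ []) (d ∷ c))) (cong (_++ d ∷ c) (sym (unfold-reverse d c)))

  center-factor : ∀ z k j c → PalFactor z (0^ k ++ I ∷ F c ++ 0^ j) →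
    Factor (I ∷ F (reverse c) ++ 0^ k ++ centerWord z ++ 0^ k ++ I ∷ F c ++ 0^ j)
  center-factor z k j c f = factor-suffix (0^ j) (I ∷ F (reverse c) ++ 0^ k ++ X) (subst Factor (reverse-arm k c j X) f)
    where
    X : List Letter
    X = centerWord z ++ 0^ k ++ I ∷ F c ++ 0^ j

  center-preimage : ∀ z k j c → Factor (I ∷ F (reverse c) ++ 0^ k ++ centerWord z ++ 0^ k ++ I ∷ F c ++ 0^ j) →
    PalPreimage z k c
  center-preimage z k j c f with factor-after-I f
  ... | C , e , FC≡ , fC with F-cancelˡ C (reverse c) (trans FC≡ (++-assoc (F (reverse c)) _ e))
  ... | C' , refl , FC'≡ = preimage-from-image z fC (trans FC'≡
        (solve 6 (λ K W i Fc J E → (K ⊕ (W ⊕ (K ⊕ (i ⊕ (Fc ⊕ J))))) ⊕ E ⊜ K ⊕ (W ⊕ (K ⊕ (i ⊕ (Fc ⊕ (J ⊕ E))))))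
               refl (0^ k) (centerWord z) (I ∷ []) (F c) (0^ j) e))

  pal-preimage : ∀ z k j c → PalFactor z (0^ k ++ I ∷ F c ++ 0^ j) → PalPreimage z k c
  pal-preimage z k j c f = center-preimage z k j c (center-factor z k j c f)

  record ArmShape (z : Maybe Letter) (p : List Letter) : Set where
    constructor shape
    field
      k j      : ℕ
      c        : List Letter
      p≡       : p ≡ 0^ k ++ I ∷ F c ++ 0^ j
      k≤a      : k ≤ a
      j≤a      : j ≤ a
      preimage : PalPreimage z k c

  after-I-shape : ∀ {t} → Factor (I ∷ t) → ∃₂ λ c j → t ≡ F c ++ 0^ j × j ≤ a
  after-I-shape {t} f with factor-after-I f
  ... | C , _ , FC≡ , _ = F-prefix-shape C t FC≡

  arm-shape-after-block : ∀ z {k t} → k ≤ a → PalFactor z (0^ k ++ I ∷ t) → (∃₂ λ c j → t ≡ F c ++ 0^ j × j ≤ a) →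
    ArmShape z (0^ k ++ I ∷ t)
  arm-shape-after-block z {k} k≤a f (c , j , refl , j≤a) = shape k j c refl k≤a j≤a (pal-preimage z k j c f)

  arm-shape : ∀ z p → PalFactor z p → suc a ≤ length p → ArmShape z p
  arm-shape z p f long with leading-zeros (suc a) p long
  ... | inj₁ (e , refl) = ⊥-elim (<-irrefl refl (factor-zero-run-≤ [] (arm-factor z p f)))
  ... | inj₂ (k , t , s≤s k≤a , refl) =
    arm-shape-after-block z k≤a f (after-I-shape (factor-suffix (0^ k) (I ∷ t) (arm-factor z _ f)))

  -- the length of 0^a 1 φ(0^t) 0^a, the longest possible arm 0^k 1 φ(c) 0^j with |c| = t
  maxArmLength : ℕ → ℕ
  maxArmLength t = a + suc (suc a * t + a)

  <maxArmLength : ∀ t → t < maxArmLength t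
  <maxArmLength t = ≤-trans (s≤s (≤-trans (m≤n*m t (suc a)) (m≤m+n _ a))) (m≤n+m _ a)

  arm-length : ∀ {k j} c t → k ≤ a → j ≤ a → maxArmLength t ≤ length (0^ k ++ I ∷ F c ++ 0^ j) → t ≤ length c
  arm-length {k} {j} c t k≤a j≤a long =
    *-cancelˡ-≤ (suc a) (+-cancelʳ-≤ a _ _ (s≤s⁻¹ (+-cancelˡ-≤ a _ _ (≤-trans long arm≤))))
    where
    open ≤-Reasoning
    arm≤ : length (0^ k ++ I ∷ F c ++ 0^ j) ≤ maxArmLength (length c)
    arm≤ = begin
      length (0^ k ++ I ∷ F c ++ 0^ j)  ≡⟨ length-arm k (F c) j ⟩
      k + suc (length (F c) + j)        ≤⟨ +-mono-≤ k≤a (s≤s (+-mono-≤ (length-F-≤ c) j≤a)) ⟩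
      maxArmLength (length c)           ∎

  -- Starting from maxArmLength a makes the preimage c̃ d d c of a palindrome with center 1 long enough
  -- to be desubstituted once more.
  threshold : ℕ → ℕ
  threshold zero    = maxArmLength a
  threshold (suc N) = maxArmLength (threshold N)

  threshold-0≤ : ∀ N → threshold 0 ≤ threshold N
  threshold-0≤ zero    = ≤-refl
  threshold-0≤ (suc N) = ≤-trans (threshold-0≤ N) (<⇒≤ (<maxArmLength (threshold N)))

  a<threshold : ∀ N → a < threshold N
  a<threshold N = <-≤-trans (<maxArmLength a) (threshold-0≤ N)

  N≤threshold : ∀ N → N ≤ threshold N
  N≤threshold zero    = z≤n
  N≤threshold (suc N) = ≤-trans (s≤s (N≤threshold N)) (<maxArmLength (threshold N))

  no-long-pal-center-O : (∀ x → ∃ λ m → r x ≡ 2 * m) → ∀ {c} → PalFactor (just O) c → suc a ≤ length c → ⊥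
  no-long-pal-center-O even {c} f long with arm-shape (just O) c f long
  ... | shape k _ _ _ _ _ (d , rd , _) with even d
  ... | m , rm = even≢odd m k (trans (sym rm) rd)

  no-long-pal-center-I : (∀ x → ∃ λ m → r x ≡ suc (2 * m)) → ∀ {c} → PalFactor (just I) c → threshold 0 ≤ length c → ⊥
  no-long-pal-center-I odd {c} f long with arm-shape (just I) c f (≤-trans (a<threshold 0) long)
  ... | shape k j c' refl k≤a j≤a (d , _ , fd) with arm-shape nothing (d ∷ c') fd (s≤s (arm-length c' a k≤a j≤a long))
  ... | shape k₂ _ _ _ _ _ (d₂ , rd₂ , _) with odd d₂
  ... | m , rm = even≢odd k₂ m (trans (sym rd₂) rm)

  even-center-unique : ∀ {d d'} k k' {c c'} → r d ≡ 2 * k → r d' ≡ 2 * k' →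
    PalFactor (just d) c → PalFactor (just d') c' → suc a ≤ length c → suc a ≤ length c' → d ≡ d'
  even-center-unique {O} {O} _ _  _  _   _ _  _ _  = refl
  even-center-unique {I} {I} _ _  _  _   _ _  _ _  = refl
  even-center-unique {O} {I} k k' rd rd' f _  l _  = ⊥-elim (no-long-pal-center-O (λ { O → k , rd ; I → k' , rd' }) f l)
  even-center-unique {I} {O} k k' rd rd' _ f' _ l' = ⊥-elim (no-long-pal-center-O (λ { O → k' , rd' ; I → k , rd }) f' l')

  odd-center-unique : ∀ {d d'} k k' {c c'} → r d ≡ suc (2 * k) → r d' ≡ suc (2 * k') →
    PalFactor (just d) c → PalFactor (just d') c' → threshold 0 ≤ length c → threshold 0 ≤ length c' → d ≡ d'
  odd-center-unique {O} {O} _ _  _  _   _ _  _ _  = refl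
  odd-center-unique {I} {I} _ _  _  _   _ _  _ _  = refl
  odd-center-unique {O} {I} k k' rd rd' _ f' _ l' = ⊥-elim (no-long-pal-center-I (λ { O → k , rd ; I → k' , rd' }) f' l')
  odd-center-unique {I} {O} k k' rd rd' f _  l _  = ⊥-elim (no-long-pal-center-I (λ { O → k' , rd' ; I → k , rd }) f l)

  length-arm-prefix : ∀ k {N c} → N ≤ length c → k + suc (2 * N) ≤ length (0^ k ++ I ∷ F (take N c))
  length-arm-prefix k {N} {c} N≤c = begin
    k + suc (2 * N)                            ≡⟨ cong (λ n → k + suc (2 * n)) (sym (trans (length-take N c) (m≤n⇒m⊓n≡m N≤c))) ⟩
    k + suc (2 * length (take N c))            ≤⟨ +-monoʳ-≤ k (s≤s (length-F-≥ (take N c))) ⟩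
    k + suc (length (F (take N c)))            ≡⟨ cong (_+ suc (length (F (take N c)))) (sym (length-replicate k)) ⟩
    length (0^ k) + length (I ∷ F (take N c))  ≡⟨ sym (length-++ (0^ k)) ⟩
    length (0^ k ++ I ∷ F (take N c))          ∎
    where open ≤-Reasoning

  take-arm : ∀ k {N c} M e → N ≤ length c → M ≤ k + suc (2 * N) →
    take M (0^ k ++ I ∷ F c ++ e) ≡ take M (0^ k ++ I ∷ F (take N c))
  take-arm k {N} {c} M e N≤c M≤ = begin
    take M (0^ k ++ I ∷ F c ++ e)
      ≡⟨ cong (λ t → take M (0^ k ++ I ∷ F t ++ e)) (sym (take++drop≡id N c)) ⟩
    take M (0^ k ++ I ∷ F (take N c ++ drop N c) ++ e)
      ≡⟨ cong (λ t → take M (0^ k ++ I ∷ t ++ e)) (F-++ (take N c) (drop N c)) ⟩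
    take M (0^ k ++ I ∷ (F (take N c) ++ F (drop N c)) ++ e)
      ≡⟨ cong (take M) (solve 5 (λ K i X Y E → K ⊕ (i ⊕ ((X ⊕ Y) ⊕ E)) ⊜ (K ⊕ (i ⊕ X)) ⊕ (Y ⊕ E))
                                 refl (0^ k) (I ∷ []) (F (take N c)) (F (drop N c)) e) ⟩
    take M ((0^ k ++ I ∷ F (take N c)) ++ F (drop N c) ++ e)
      ≡⟨ take-++ˡ M (0^ k ++ I ∷ F (take N c)) (≤-trans M≤ (length-arm-prefix k N≤c)) ⟩
    take M (0^ k ++ I ∷ F (take N c)) ∎
    where open ≡-Reasoning

  take-arm-agree : ∀ k {N c c'} M e e' → take N c ≡ take N c' → N ≤ length c → N ≤ length c' → M ≤ k + suc (2 * N) →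
    take M (0^ k ++ I ∷ F c ++ e) ≡ take M (0^ k ++ I ∷ F c' ++ e')
  take-arm-agree k M e e' c≈c' N≤c N≤c' M≤ =
    trans (take-arm k M e N≤c M≤) (trans (cong (λ t → take M (0^ k ++ I ∷ F t)) c≈c') (sym (take-arm k M e' N≤c' M≤)))

  PrefixesAgree : ℕ → Set
  PrefixesAgree N = ∀ z {p q} → PalFactor z p → PalFactor z q → threshold N ≤ length p → threshold N ≤ length q →
    take N p ≡ take N q

  arms-agree : ∀ {N} → PrefixesAgree N → ∀ {d} k {c c'} e e' → PalFactor (just d) c → PalFactor (just d) c' →
    threshold N ≤ length c → threshold N ≤ length c' → take (suc N) (0^ k ++ I ∷ F c ++ e) ≡ take (suc N) (0^ k ++ I ∷ F c' ++ e')
  arms-agree {N} agree {d} k e e' f f' l l' =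
    take-arm-agree k (suc N) e e' (agree (just d) f f' l l') (≤-trans (N≤threshold N) l) (≤-trans (N≤threshold N) l') (n<m+1+2n k N)

  agree-step : ∀ {N} → PrefixesAgree N → ∀ z {k k' j j' c c'} → PalPreimage z k c → PalPreimage z k' c' →
    threshold N ≤ length c → threshold N ≤ length c' →
    take (suc N) (0^ k ++ I ∷ F c ++ 0^ j) ≡ take (suc N) (0^ k' ++ I ∷ F c' ++ 0^ j')
  agree-step {N} agree nothing {k} {k'} (d , rd , f) (d' , rd' , f') l l'
    with even-center-unique k k' rd rd' f f' (≤-trans (a<threshold N) l) (≤-trans (a<threshold N) l')
  ... | refl with *-cancelˡ-≡ k k' 2 (trans (sym rd) rd')
  ... | refl = arms-agree agree k _ _ f f' l l'
  agree-step {N} agree (just O) {k} {k'} (d , rd , f) (d' , rd' , f') l l'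
    with odd-center-unique k k' rd rd' f f' (≤-trans (threshold-0≤ N) l) (≤-trans (threshold-0≤ N) l')
  ... | refl with *-cancelˡ-≡ k k' 2 (suc-injective (trans (sym rd) rd'))
  ... | refl = arms-agree agree k _ _ f f' l l'
  agree-step {zero} _ (just I) (d , refl , _) (d' , refl , _) _ _ =
    trans (take-1-0^ _ (1≤r d)) (sym (take-1-0^ _ (1≤r d')))
  agree-step {suc N} agree (just I) {c = c} {c'} (d , refl , f) (d' , refl , f') l l'
    with ∷-injective (agree nothing f f' (≤-trans l (n≤1+n _)) (≤-trans l' (n≤1+n _)))
  ... | refl , c≈c' =
    take-arm-agree (r d) (suc (suc N)) _ _ c≈c' (N≤ c l) (N≤ c' l') (+-mono-≤ (1≤r d) (s≤s (m≤n*m N 2)))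
    where
    N≤ : ∀ x → threshold (suc N) ≤ length x → N ≤ length x
    N≤ _ lx = ≤-trans (n≤1+n N) (≤-trans (N≤threshold (suc N)) lx)

  long-palindromes-agree : ∀ N → PrefixesAgree N
  long-palindromes-agree zero    _ _ _ _ _ = refl
  long-palindromes-agree (suc N) z {p} {q} fp fq lp lq
    with arm-shape z p fp (≤-trans (a<threshold (suc N)) lp) | arm-shape z q fq (≤-trans (a<threshold (suc N)) lq)
  ... | shape k j c refl k≤a j≤a pre | shape k' j' c' refl k'≤a j'≤a pre' =
    agree-step (long-palindromes-agree N) z pre pre' (arm-length c _ k≤a j≤a lp) (arm-length c' _ k'≤a j'≤a lq)

lemma5p15 : (a b : ℕ) → 1 ≤ b → b + 1 < a →
    (z : Maybe Letter) → (v w : ℕ → Letter) →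
    IsPalBranch (u a b) z v → IsPalBranch (u a b) z w →
    (n : ℕ) → v n ≡ w n
lemma5p15 a b 1≤b b+1<a z v w v-branch w-branch n = prefix-last v w n (begin
  prefix v (suc n)           ≡⟨ sym (take-prefix v (N≤threshold (suc n))) ⟩
  take (suc n) (prefix v L)  ≡⟨ long-palindromes-agree (suc n) z (u-factor (v-branch L)) (u-factor (w-branch L))
                                  (long-enough v) (long-enough w) ⟩
  take (suc n) (prefix w L)  ≡⟨ take-prefix w (N≤threshold (suc n)) ⟩
  prefix w (suc n)           ∎)
  where
  b<a : b < a
  b<a = <-trans (m<m+n b (s≤s z≤n)) b+1<a
  open Substitution a b 1≤b b<a
  open Palindromes a b 1≤b b<a
  open ≡-Reasoning
  L : ℕ
  L = threshold (suc n)
  long-enough : ∀ x → threshold (suc n) ≤ length (prefix x L)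
  long-enough x = ≤-reflexive (sym (length-prefix x L))
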